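{- Let $G$ be a $(2K_2, HVN)$-free graph. Then $\chi(G) \leq \omega(G)+3$.
   Context: All graphs are finite, simple and undirected. $2K_2$ is the disjoint union of two edges. $HVN$ is the graph obtained from $K_4$ by adding one new vertex adjacent to exactly two vertices of the $K_4$. A graph is $\mathcal{F}$-free if it has no induced subgraph isomorphic to a member of $\mathcal{F}$. $\chi$ is the chromatic number and $\omega$ the clique number. -}

module Defs where

open import Data.Nat using (ℕ; _≤_)
open import Data.Fin using (Fin; zero; suc)
open import Data.Bool using (Bool; true; false)
open import Data.Product using (Σ; _×_; ∃)
open import Relation.Binary.PropositionalEquality using (_≡_; _≢_)
open import Relation.Nullary using (¬_)
open import Function.Definitions using (Injective)

record Graph (n : ℕ) : Set where
  field
    adj   : Fin n → Fin n → Bool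
    sym   : ∀ i j → adj i j ≡ adj j i
    irrefl : ∀ i → adj i i ≡ false
open Graph public

InducedSub : ∀ {k n} → Graph k → Graph n → Set
InducedSub {k} {n} H G =
  Σ (Fin k → Fin n) λ f → Injective _≡_ _≡_ f × (∀ i j → adj G (f i) (f j) ≡ adj H i j)

HasClique : ∀ {n} → Graph n → ℕ → Set
HasClique {n} G k =
  Σ (Fin k → Fin n) λ f → Injective _≡_ _≡_ f × (∀ i j → i ≢ j → adj G (f i) (f j) ≡ true)

IsCliqueNumber : ∀ {n} → Graph n → ℕ → Set
IsCliqueNumber G w = HasClique G w × (∀ k → HasClique G k → k ≤ w)

Colourable : ∀ {n} → Graph n → ℕ → Set
Colourable {n} G c =
  Σ (Fin n → Fin c) λ col → ∀ i j → adj G i j ≡ true → col i ≢ col j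

twoK2-adj : Fin 4 → Fin 4 → Bool
twoK2-adj zero (suc zero) = true
twoK2-adj (suc zero) zero = true
twoK2-adj (suc (suc zero)) (suc (suc (suc zero))) = true
twoK2-adj (suc (suc (suc zero))) (suc (suc zero)) = true
twoK2-adj _ _ = false

twoK2 : Graph 4
twoK2 = record { adj = twoK2-adj ; sym = s ; irrefl = r }
  where
  s : ∀ i j → twoK2-adj i j ≡ twoK2-adj j i
  s zero zero = _≡_.refl
  s zero (suc zero) = _≡_.refl
  s zero (suc (suc zero)) = _≡_.refl
  s zero (suc (suc (suc zero))) = _≡_.refl
  s (suc zero) zero = _≡_.refl
  s (suc zero) (suc zero) = _≡_.refl
  s (suc zero) (suc (suc zero)) = _≡_.refl
  s (suc zero) (suc (suc (suc zero))) = _≡_.refl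
  s (suc (suc zero)) zero = _≡_.refl
  s (suc (suc zero)) (suc zero) = _≡_.refl
  s (suc (suc zero)) (suc (suc zero)) = _≡_.refl
  s (suc (suc zero)) (suc (suc (suc zero))) = _≡_.refl
  s (suc (suc (suc zero))) zero = _≡_.refl
  s (suc (suc (suc zero))) (suc zero) = _≡_.refl
  s (suc (suc (suc zero))) (suc (suc zero)) = _≡_.refl
  s (suc (suc (suc zero))) (suc (suc (suc zero))) = _≡_.refl
  r : ∀ i → twoK2-adj i i ≡ false
  r zero = _≡_.refl
  r (suc zero) = _≡_.refl
  r (suc (suc zero)) = _≡_.refl
  r (suc (suc (suc zero))) = _≡_.refl

-- HVN: K₄ on vertices 0,1,2,3 plus vertex 4 adjacent exactly to 0 and 1.
hvn-adj : Fin 5 → Fin 5 → Bool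
hvn-adj zero zero = false
hvn-adj (suc zero) (suc zero) = false
hvn-adj (suc (suc zero)) (suc (suc zero)) = false
hvn-adj (suc (suc (suc zero))) (suc (suc (suc zero))) = false
hvn-adj (suc (suc (suc (suc zero)))) zero = true
hvn-adj (suc (suc (suc (suc zero)))) (suc zero) = true
hvn-adj (suc (suc (suc (suc zero)))) _ = false
hvn-adj zero (suc (suc (suc (suc zero)))) = true
hvn-adj (suc zero) (suc (suc (suc (suc zero)))) = true
hvn-adj _ (suc (suc (suc (suc zero)))) = false
hvn-adj _ _ = true

hvn : Graph 5
hvn = record { adj = hvn-adj ; sym = s ; irrefl = r }
  where
  s : ∀ i j → hvn-adj i j ≡ hvn-adj j i
  s zero zero = _≡_.refl
  s zero (suc zero) = _≡_.refl
  s zero (suc (suc zero)) = _≡_.refl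
  s zero (suc (suc (suc zero))) = _≡_.refl
  s zero (suc (suc (suc (suc zero)))) = _≡_.refl
  s (suc zero) zero = _≡_.refl
  s (suc zero) (suc zero) = _≡_.refl
  s (suc zero) (suc (suc zero)) = _≡_.refl
  s (suc zero) (suc (suc (suc zero))) = _≡_.refl
  s (suc zero) (suc (suc (suc (suc zero)))) = _≡_.refl
  s (suc (suc zero)) zero = _≡_.refl
  s (suc (suc zero)) (suc zero) = _≡_.refl
  s (suc (suc zero)) (suc (suc zero)) = _≡_.refl
  s (suc (suc zero)) (suc (suc (suc zero))) = _≡_.refl
  s (suc (suc zero)) (suc (suc (suc (suc zero)))) = _≡_.refl
  s (suc (suc (suc zero))) zero = _≡_.refl
  s (suc (suc (suc zero))) (suc zero) = _≡_.refl
  s (suc (suc (suc zero))) (suc (suc zero)) = _≡_.refl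
  s (suc (suc (suc zero))) (suc (suc (suc zero))) = _≡_.refl
  s (suc (suc (suc zero))) (suc (suc (suc (suc zero)))) = _≡_.refl
  s (suc (suc (suc (suc zero)))) zero = _≡_.refl
  s (suc (suc (suc (suc zero)))) (suc zero) = _≡_.refl
  s (suc (suc (suc (suc zero)))) (suc (suc zero)) = _≡_.refl
  s (suc (suc (suc (suc zero)))) (suc (suc (suc zero))) = _≡_.refl
  s (suc (suc (suc (suc zero)))) (suc (suc (suc (suc zero)))) = _≡_.refl
  r : ∀ i → hvn-adj i i ≡ false
  r zero = _≡_.refl
  r (suc zero) = _≡_.refl
  r (suc (suc zero)) = _≡_.refl
  r (suc (suc (suc zero))) = _≡_.refl
  r (suc (suc (suc (suc zero)))) = _≡_.refl

-- Fix a maximum clique Q. Maximality means every vertex outside Q misses some vertex of Q.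
-- A vertex of Q, or a vertex missing only Q i, gets colour i: two adjacent vertices missing
-- only Q i could replace Q i and enlarge the clique. A vertex missing at least two vertices of
-- Q sees at most one vertex of Q, since otherwise there is an induced HVN. So, fixing three
-- vertices of Q, it misses one of the three pairs among them, which gives it one of three
-- further colours (if w ≤ 2 it misses all of Q and one colour suffices). Two adjacent vertices
-- missing the same pair of Q would form an induced 2K₂ with that pair.

module Submission where

open import Data.Bool using (Bool; true; false)
open import Data.Bool.Properties using (¬-not; not-¬) renaming (_≟_ to _≟ᵇ_)
open import Data.Empty using (⊥-elim)
open import Data.Fin using (Fin; zero; suc; Fin′; inject; _<_; join; splitAt)
open import Data.Fin.Properties using (_≟_; <-cmp; any?; all?; splitAt-join)
open import Data.Nat using (ℕ; _+_; _≤_; suc; s<s)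
open import Data.Nat.Properties using (1+n≰n)
open import Data.Product using (∃; ∃₂; _×_; _,_; proj₁; proj₂)
open import Data.Sum using (_⊎_; inj₁; inj₂)
open import Data.Sum.Properties using (inj₁-injective; inj₂-injective)
open import Data.Vec.Functional using ([]; _∷_; updateAt)
open import Data.Vec.Functional.Properties using (updateAt-updates; updateAt-minimal)
open import Function using (_∘_)
open import Function.Definitions using (Injective)
open import Relation.Binary.Definitions using (tri<; tri≈; tri>)
open import Relation.Binary.PropositionalEquality
  using (_≡_; _≢_; refl; sym; trans; cong; subst; subst₂; module ≡-Reasoning)
open import Relation.Nullary using (¬_; Dec; yes; no; ¬?)
open import Relation.Nullary.Decidable using (_→-dec_; _×-dec_; toWitness)

open import Defs hiding (sym)

adjacent⇒distinct : ∀ {n} (G : Graph n) {u v} → adj G u v ≡ true → u ≢ v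
adjacent⇒distinct G {u} uv refl = not-¬ uv (irrefl G u)

PointDetermining : ∀ {k} → Graph k → Set
PointDetermining {k} H = ∀ i j → i ≢ j → ∃ λ l → adj H i l ≢ adj H j l

point-determining? : ∀ {k} (H : Graph k) → Dec (PointDetermining H)
point-determining? H =
  all? λ i → all? λ j → ¬? (i ≟ j) →-dec any? λ l → ¬? (adj H i l ≟ᵇ adj H j l)

twoK2-point-determining : PointDetermining twoK2
twoK2-point-determining = toWitness {a? = point-determining? twoK2} _

hvn-point-determining : PointDetermining hvn
hvn-point-determining = toWitness {a? = point-determining? hvn} _

AdjacencyPreserving : ∀ {k n} → Graph k → Graph n → (Fin k → Fin n) → Set
AdjacencyPreserving H G f = ∀ i j → adj G (f i) (f j) ≡ adj H i j

-- inject i ranges over the indices below j: only pairs above the diagonal are constrained.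
UpperAdjacencyPreserving : ∀ {k n} → Graph k → Graph n → (Fin k → Fin n) → Set
UpperAdjacencyPreserving H G f = ∀ j (i : Fin′ j) → adj G (f (inject i)) (f j) ≡ adj H (inject i) j

<⇒inject : ∀ {k} {i j : Fin k} → i < j → ∃ λ (i′ : Fin′ j) → inject i′ ≡ i
<⇒inject {i = zero}  {suc j} _         = zero , refl
<⇒inject {i = suc i} {suc j} (s<s i<j) with <⇒inject i<j
... | i′ , refl = suc i′ , refl

module _ {k n} {H : Graph k} {G : Graph n} where

  upper-preserving⇒preserving : ∀ {f} → UpperAdjacencyPreserving H G f → AdjacencyPreserving H G f
  upper-preserving⇒preserving {f} upper i j with <-cmp i j
  ... | tri< i<j _ _ with <⇒inject i<j
  ...   | i′ , refl = upper j i′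
  upper-preserving⇒preserving {f} upper i j | tri≈ _ refl _ = trans (irrefl G (f i)) (sym (irrefl H i))
  upper-preserving⇒preserving {f} upper i j | tri> _ _ j<i with <⇒inject j<i
  ...   | j′ , refl = trans (Graph.sym G (f i) (f j)) (trans (upper i j′) (Graph.sym H j i))

  -- Equal images would make i and j twins in H.
  preserving⇒injective : ∀ {f} → PointDetermining H → AdjacencyPreserving H G f → Injective _≡_ _≡_ f
  preserving⇒injective {f} point-determining preserving {i} {j} fi≡fj with i ≟ j
  ... | yes i≡j = i≡j
  ... | no i≢j with point-determining i j i≢j
  ...   | l , differ = ⊥-elim (differ (begin
          adj H i l         ≡⟨ sym (preserving i l) ⟩
          adj G (f i) (f l) ≡⟨ cong (λ x → adj G x (f l)) fi≡fj ⟩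
          adj G (f j) (f l) ≡⟨ preserving j l ⟩
          adj H j l         ∎))
    where open ≡-Reasoning

  upper-preserving⇒InducedSub : PointDetermining H → ∀ f → UpperAdjacencyPreserving H G f
    → InducedSub H G
  upper-preserving⇒InducedSub point-determining f upper =
    f , preserving⇒injective point-determining preserving , preserving
    where
    preserving : AdjacencyPreserving H G f
    preserving = upper-preserving⇒preserving upper

module _ {n} (G : Graph n) where

  twoK2-induced : ∀ {a b c d} → adj G a b ≡ true → adj G c d ≡ true
    → adj G a c ≡ false → adj G a d ≡ false → adj G b c ≡ false → adj G b d ≡ false
    → InducedSub twoK2 G
  twoK2-induced {a} {b} {c} {d} ab cd ac ad bc bd =
    upper-preserving⇒InducedSub {H = twoK2} {G = G}
      twoK2-point-determining (a ∷ b ∷ c ∷ d ∷ []) upper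
    where
    upper : UpperAdjacencyPreserving twoK2 G (a ∷ b ∷ c ∷ d ∷ [])
    upper zero ()
    upper (suc zero) zero = ab
    upper (suc (suc zero)) zero = ac
    upper (suc (suc zero)) (suc zero) = bc
    upper (suc (suc (suc zero))) zero = ad
    upper (suc (suc (suc zero))) (suc zero) = bd
    upper (suc (suc (suc zero))) (suc (suc zero)) = cd

  hvn-induced : ∀ {a b c d e}
    → adj G a b ≡ true → adj G a c ≡ true → adj G a d ≡ true
    → adj G b c ≡ true → adj G b d ≡ true → adj G c d ≡ true
    → adj G a e ≡ true → adj G b e ≡ true → adj G c e ≡ false → adj G d e ≡ false
    → InducedSub hvn G
  hvn-induced {a} {b} {c} {d} {e} ab ac ad bc bd cd ae be ce de =
    upper-preserving⇒InducedSub {H = hvn} {G = G}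
      hvn-point-determining (a ∷ b ∷ c ∷ d ∷ e ∷ []) upper
    where
    upper : UpperAdjacencyPreserving hvn G (a ∷ b ∷ c ∷ d ∷ e ∷ [])
    upper zero ()
    upper (suc zero) zero = ab
    upper (suc (suc zero)) zero = ac
    upper (suc (suc zero)) (suc zero) = bc
    upper (suc (suc (suc zero))) zero = ad
    upper (suc (suc (suc zero))) (suc zero) = bd
    upper (suc (suc (suc zero))) (suc (suc zero)) = cd
    upper (suc (suc (suc (suc zero)))) zero = ae
    upper (suc (suc (suc (suc zero)))) (suc zero) = be
    upper (suc (suc (suc (suc zero)))) (suc (suc zero)) = ce
    upper (suc (suc (suc (suc zero)))) (suc (suc (suc zero))) = de

IsClique : ∀ {n k} → Graph n → (Fin k → Fin n) → Set
IsClique G f = ∀ i j → i ≢ j → adj G (f i) (f j) ≡ true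

updateAt-view : ∀ {A : Set} {k} (f : Fin k → A) i {u : A} j
  → (j ≡ i × updateAt f i (λ _ → u) j ≡ u) ⊎ (j ≢ i × updateAt f i (λ _ → u) j ≡ f j)
updateAt-view f i j with j ≟ i
... | yes refl = inj₁ (refl , updateAt-updates i f)
... | no j≢i   = inj₂ (j≢i , updateAt-minimal j i f j≢i)

module _ {n} (G : Graph n) where

  private
    Edge : Fin n → Fin n → Set
    Edge u v = adj G u v ≡ true

  clique-extend : ∀ {k} {f : Fin k → Fin n} {v} → Injective _≡_ _≡_ f → IsClique G f
    → (∀ i → f i ≢ v) → (∀ i → Edge v (f i)) → HasClique G (suc k)
  clique-extend {f = f} {v} f-injective f-clique v∉f v-sees = v ∷ f , injective , clique
    where
    injective : Injective _≡_ _≡_ (v ∷ f)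
    injective {zero}  {zero}  _      = refl
    injective {zero}  {suc j} v≡fj  = ⊥-elim (v∉f j (sym v≡fj))
    injective {suc i} {zero}  fi≡v  = ⊥-elim (v∉f i fi≡v)
    injective {suc i} {suc j} fi≡fj = cong suc (f-injective fi≡fj)
    clique : IsClique G (v ∷ f)
    clique zero    zero    0≢0 = ⊥-elim (0≢0 refl)
    clique zero    (suc j) _   = v-sees j
    clique (suc i) zero    _   = trans (Graph.sym G (f i) v) (v-sees i)
    clique (suc i) (suc j) i≢j = f-clique i j (i≢j ∘ cong suc)

  -- The new clique is f with f i replaced by u, extended by v.
  clique-exchange : ∀ {k} {f : Fin k → Fin n} i {u v} → Injective _≡_ _≡_ f → IsClique G f
    → (∀ j → f j ≢ u) → (∀ j → f j ≢ v) → Edge u v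
    → (∀ j → j ≢ i → Edge u (f j)) → (∀ j → j ≢ i → Edge v (f j))
    → HasClique G (suc k)
  clique-exchange {f = f} i {u} {v} f-injective f-clique u∉f v∉f uv u-sees v-sees =
    clique-extend g-injective g-clique v∉g v-sees-g
    where
    g : Fin _ → Fin n
    g = updateAt f i (λ _ → u)
    g-injective : Injective _≡_ _≡_ g
    g-injective {a} {b} ga≡gb with updateAt-view f i a | updateAt-view f i b
    ... | inj₁ (refl , _)   | inj₁ (refl , _)   = refl
    ... | inj₁ (_ , ga≡u)   | inj₂ (_ , gb≡fb)  =
      ⊥-elim (u∉f b (trans (sym gb≡fb) (trans (sym ga≡gb) ga≡u)))
    ... | inj₂ (_ , ga≡fa)  | inj₁ (_ , gb≡u)   =
      ⊥-elim (u∉f a (trans (sym ga≡fa) (trans ga≡gb gb≡u)))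
    ... | inj₂ (_ , ga≡fa)  | inj₂ (_ , gb≡fb)  =
      f-injective (trans (sym ga≡fa) (trans ga≡gb gb≡fb))
    g-clique : IsClique G g
    g-clique a b a≢b with updateAt-view f i a | updateAt-view f i b
    ... | inj₁ (refl , _)      | inj₁ (refl , _)      = ⊥-elim (a≢b refl)
    ... | inj₁ (_ , ga≡u)      | inj₂ (b≢i , gb≡fb)   =
      subst₂ Edge (sym ga≡u) (sym gb≡fb) (u-sees b b≢i)
    ... | inj₂ (a≢i , ga≡fa)   | inj₁ (_ , gb≡u)      =
      subst₂ Edge (sym ga≡fa) (sym gb≡u) (trans (Graph.sym G (f a) u) (u-sees a a≢i))
    ... | inj₂ (_ , ga≡fa)     | inj₂ (_ , gb≡fb)     =
      subst₂ Edge (sym ga≡fa) (sym gb≡fb) (f-clique a b a≢b)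
    v∉g : ∀ j → g j ≢ v
    v∉g j gj≡v with updateAt-view f i j
    ... | inj₁ (_ , gj≡u)  = adjacent⇒distinct G uv (trans (sym gj≡u) gj≡v)
    ... | inj₂ (_ , gj≡fj) = v∉f j (trans (sym gj≡fj) gj≡v)
    v-sees-g : ∀ j → Edge v (g j)
    v-sees-g j with updateAt-view f i j
    ... | inj₁ (_ , gj≡u)    = subst (Edge v) (sym gj≡u) (trans (Graph.sym G v u) uv)
    ... | inj₂ (j≢i , gj≡fj) = subst (Edge v) (sym gj≡fj) (v-sees j j≢i)

colourable-⊎ : ∀ {n a b} (G : Graph n) (colour : Fin n → Fin a ⊎ Fin b)
  → (∀ u v → adj G u v ≡ true → colour u ≢ colour v) → Colourable G (a + b)
colourable-⊎ {a = a} {b} G colour proper =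
  join a b ∘ colour , λ u v uv same → proper u v uv (join-injective same)
  where
  join-injective : ∀ {x y} → join a b x ≡ join a b y → x ≡ y
  join-injective {x} {y} eq =
    trans (sym (splitAt-join a b x)) (trans (cong (splitAt a) eq) (splitAt-join a b y))

HasThreeDistinct : Set → Set
HasThreeDistinct A = ∃₂ λ (a b : A) → ∃ λ c → a ≢ b × a ≢ c × b ≢ c

CoveredByAnyPair : Set → Set
CoveredByAnyPair A = ∀ (a b c : A) → a ≢ b → c ≡ a ⊎ c ≡ b

fin-three-distinct-or-covered : ∀ w → HasThreeDistinct (Fin w) ⊎ CoveredByAnyPair (Fin w)
fin-three-distinct-or-covered 0 = inj₂ λ ()
fin-three-distinct-or-covered 1 = inj₂ λ { zero zero _ 0≢0 → ⊥-elim (0≢0 refl) }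
fin-three-distinct-or-covered 2 = inj₂ covered
  where
  covered : CoveredByAnyPair (Fin 2)
  covered zero       zero       _ 0≢0 = ⊥-elim (0≢0 refl)
  covered zero       (suc zero) zero       _ = inj₁ refl
  covered zero       (suc zero) (suc zero) _ = inj₂ refl
  covered (suc zero) zero       zero       _ = inj₂ refl
  covered (suc zero) zero       (suc zero) _ = inj₁ refl
  covered (suc zero) (suc zero) _ 1≢1 = ⊥-elim (1≢1 refl)
fin-three-distinct-or-covered (suc (suc (suc w))) =
  inj₁ (zero , suc zero , suc (suc zero) , (λ ()) , (λ ()) , (λ ()))

module MaximumClique {n} (G : Graph n) {w} (Q : Fin w → Fin n)
  (Q-injective : Injective _≡_ _≡_ Q) (Q-clique : IsClique G Q)
  (Q-maximum : ∀ k → HasClique G k → k ≤ w) where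

  Outside : Fin n → Set
  Outside v = ∀ i → Q i ≢ v

  Misses : Fin n → Fin w → Set
  Misses v i = adj G v (Q i) ≡ false

  MissesBoth : Fin n → Fin w × Fin w → Set
  MissesBoth v (i , j) = Misses v i × Misses v j

  MissesTwo : Fin n → Set
  MissesTwo v = ∃₂ λ i j → i ≢ j × MissesBoth v (i , j)

  SharedMissedPair : Fin n → Fin n → Set
  SharedMissedPair u v = ∃₂ λ i j → i ≢ j × MissesBoth u (i , j) × MissesBoth v (i , j)

  outside⇒misses-some : ∀ {v} → Outside v → ∃ (Misses v)
  outside⇒misses-some {v} v∉Q with any? (λ i → adj G v (Q i) ≟ᵇ false)
  ... | yes missed = missed
  ... | no ¬missed = ⊥-elim (1+n≰n (Q-maximum (suc w)
          (clique-extend G Q-injective Q-clique v∉Q λ i → ¬-not λ v-i → ¬missed (i , v-i))))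

  single-missers-nonadjacent : ∀ {u v} i → Outside u → Outside v
    → (∀ j → j ≢ i → adj G u (Q j) ≡ true) → (∀ j → j ≢ i → adj G v (Q j) ≡ true)
    → adj G u v ≢ true
  single-missers-nonadjacent i u∉Q v∉Q u-sees v-sees uv =
    1+n≰n (Q-maximum (suc w) (clique-exchange G i Q-injective Q-clique u∉Q v∉Q uv u-sees v-sees))

  hvn-free⇒sees-at-most-one : ¬ InducedSub hvn G → ∀ {v} → MissesTwo v
    → ∀ {k l} → k ≢ l → adj G v (Q k) ≡ true → Misses v l
  hvn-free⇒sees-at-most-one no-hvn {v} (i , j , i≢j , v-i , v-j) {k} {l} k≢l v-k
    with adj G v (Q l) ≟ᵇ false
  ... | yes v-l  = v-l
  ... | no ¬v-l = ⊥-elim (no-hvn (hvn-induced G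
        (Q-clique k l k≢l) (seen⇒missed-adjacent v-k v-i) (seen⇒missed-adjacent v-k v-j)
        (seen⇒missed-adjacent v-l v-i) (seen⇒missed-adjacent v-l v-j) (Q-clique i j i≢j)
        (flipped v-k) (flipped v-l) (flipped v-i) (flipped v-j)))
    where
    v-l : adj G v (Q l) ≡ true
    v-l = ¬-not ¬v-l
    seen⇒missed-adjacent : ∀ {m x} → adj G v (Q m) ≡ true → Misses v x → adj G (Q m) (Q x) ≡ true
    seen⇒missed-adjacent v-m v-x = Q-clique _ _ λ { refl → not-¬ v-m v-x }
    flipped : ∀ {m b} → adj G v (Q m) ≡ b → adj G (Q m) v ≡ b
    flipped {m} = trans (Graph.sym G (Q m) v)

  twoK2-free⇒adjacent⇒¬shared : ¬ InducedSub twoK2 G → ∀ {u v} → adj G u v ≡ true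
    → ¬ SharedMissedPair u v
  twoK2-free⇒adjacent⇒¬shared no-2K2 uv (i , j , i≢j , (u-i , u-j) , (v-i , v-j)) =
    no-2K2 (twoK2-induced G uv (Q-clique i j i≢j) u-i u-j v-i v-j)

  data Position (v : Fin n) : Set where
    in-clique   : ∀ i → Q i ≡ v → Position v
    misses-only : ∀ i → Outside v → Misses v i → (∀ j → j ≢ i → adj G v (Q j) ≡ true) → Position v
    misses-two  : MissesTwo v → Position v

  outside-position : ∀ {v} → Outside v → Position v
  outside-position {v} v∉Q with outside⇒misses-some v∉Q
  ... | i , v-i with any? (λ j → ¬? (j ≟ i) ×-dec (adj G v (Q j) ≟ᵇ false))
  ...   | yes (j , j≢i , v-j) = misses-two (i , j , (λ i≡j → j≢i (sym i≡j)) , v-i , v-j)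
  ...   | no ¬other = misses-only i v∉Q v-i λ j j≢i → ¬-not λ v-j → ¬other (j , j≢i , v-j)

  position : ∀ v → Position v
  position v with any? (λ i → Q i ≟ v)
  ... | yes (i , Qi≡v) = in-clique i Qi≡v
  ... | no v∉Q         = outside-position λ i Qi≡v → v∉Q (i , Qi≡v)

  module Colouring (no-2K2 : ¬ InducedSub twoK2 G) (select : Fin n → Fin 3)
    (select-shares : ∀ {u v} → MissesTwo u → MissesTwo v → select u ≡ select v
                   → SharedMissedPair u v)
    where

    colour : ∀ {v} → Position v → Fin w ⊎ Fin 3
    colour (in-clique i _)       = inj₁ i
    colour (misses-only i _ _ _) = inj₁ i
    colour {v} (misses-two _)    = inj₂ (select v)

    colour-proper : ∀ {u v} → adj G u v ≡ true → (pu : Position u) (pv : Position v)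
      → colour pu ≢ colour pv
    colour-proper uv (in-clique i refl) (in-clique j refl) same with inj₁-injective same
    ... | refl = adjacent⇒distinct G uv refl
    colour-proper {v = v} uv (in-clique i refl) (misses-only j _ v-j _) same with inj₁-injective same
    ... | refl = not-¬ (trans (Graph.sym G v (Q i)) uv) v-j
    colour-proper uv (misses-only i _ u-i _) (in-clique j refl) same with inj₁-injective same
    ... | refl = not-¬ uv u-i
    colour-proper uv (misses-only i u∉Q _ u-sees) (misses-only j v∉Q _ v-sees) same with inj₁-injective same
    ... | refl = single-missers-nonadjacent i u∉Q v∉Q u-sees v-sees uv
    colour-proper uv (misses-two u-two) (misses-two v-two) same =
      twoK2-free⇒adjacent⇒¬shared no-2K2 uv (select-shares u-two v-two (inj₂-injective same))
    colour-proper _ (in-clique _ _)       (misses-two _)        ()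
    colour-proper _ (misses-only _ _ _ _) (misses-two _)        ()
    colour-proper _ (misses-two _)        (in-clique _ _)       ()
    colour-proper _ (misses-two _)        (misses-only _ _ _ _) ()

    colourable : Colourable G (w + 3)
    colourable = colourable-⊎ G (colour ∘ position)
      λ u v uv → colour-proper uv (position u) (position v)

  covered⇒shared : CoveredByAnyPair (Fin w)
    → ∀ {u v} → MissesTwo u → MissesTwo v → SharedMissedPair u v
  covered⇒shared covered (i , j , i≢j , u-ij) (k , l , k≢l , v-k , v-l) =
    i , j , i≢j , u-ij , misses-covered (covered k l i k≢l) , misses-covered (covered k l j k≢l)
    where
    misses-covered : ∀ {m} → m ≡ k ⊎ m ≡ l → Misses _ m
    misses-covered (inj₁ refl) = v-k
    misses-covered (inj₂ refl) = v-l

  module ThreeCliqueVertices (no-hvn : ¬ InducedSub hvn G) {a b c : Fin w}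
    (a≢b : a ≢ b) (a≢c : a ≢ c) (b≢c : b ≢ c) where

    pair : Fin 3 → Fin w × Fin w
    pair zero             = b , c
    pair (suc zero)       = a , c
    pair (suc (suc zero)) = a , b

    pair-distinct : ∀ t → proj₁ (pair t) ≢ proj₂ (pair t)
    pair-distinct zero             = b≢c
    pair-distinct (suc zero)       = a≢c
    pair-distinct (suc (suc zero)) = a≢b

    -- The index of the only vertex among Q a, Q b, Q c that a MissesTwo vertex may see;
    -- such a vertex misses the complementary pair.
    neighbour-index : Bool → Bool → Fin 3
    neighbour-index true  _     = zero
    neighbour-index false true  = suc zero
    neighbour-index false false = suc (suc zero)

    select : Fin n → Fin 3
    select v = neighbour-index (adj G v (Q a)) (adj G v (Q b))

    misses-pair : ∀ {v} → MissesTwo v → ∀ x y → adj G v (Q a) ≡ x → adj G v (Q b) ≡ y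
      → MissesBoth v (pair (neighbour-index x y))
    misses-pair two true  _     v-a _   =
      hvn-free⇒sees-at-most-one no-hvn two a≢b v-a , hvn-free⇒sees-at-most-one no-hvn two a≢c v-a
    misses-pair two false true  v-a v-b = v-a , hvn-free⇒sees-at-most-one no-hvn two b≢c v-b
    misses-pair two false false v-a v-b = v-a , v-b

    select-shares : ∀ {u v} → MissesTwo u → MissesTwo v → select u ≡ select v
      → SharedMissedPair u v
    select-shares {u} {v} u-two v-two same =
      _ , _ , pair-distinct (select v) ,
      subst (MissesBoth u ∘ pair) same (misses-pair u-two _ _ refl refl) ,
      misses-pair v-two _ _ refl refl

  colourable : ¬ InducedSub twoK2 G → ¬ InducedSub hvn G
    → HasThreeDistinct (Fin w) ⊎ CoveredByAnyPair (Fin w) → Colourable G (w + 3)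
  colourable no-2K2 no-hvn (inj₁ (a , b , c , a≢b , a≢c , b≢c)) =
    Colouring.colourable no-2K2 select select-shares
    where open ThreeCliqueVertices no-hvn a≢b a≢c b≢c
  colourable no-2K2 _ (inj₂ covered) =
    Colouring.colourable no-2K2 (λ _ → zero) λ u-two v-two _ → covered⇒shared covered u-two v-two

corollary3p9 : ∀ {n} (G : Graph n) → ¬ InducedSub twoK2 G → ¬ InducedSub hvn G
    → ∀ (w : ℕ) → IsCliqueNumber G w → Colourable G (w + 3)
corollary3p9 G no-2K2 no-hvn w ((Q , Q-injective , Q-clique) , Q-maximum) =
  MaximumClique.colourable G Q Q-injective Q-clique Q-maximum no-2K2 no-hvn
    (fin-three-distinct-or-covered w)
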